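{- For any integers $k \geq 2$ and $\beta,n,\rho \geq 0$, $$C^k_{n,(0,\beta),\rho} = \frac{k\rho+\beta-\rho}{kn+\beta-\rho} \binom{kn+\beta-\rho}{n-\rho},$$ where in the single degenerate case $n=\rho=\beta=0$ the right-hand side is interpreted as $1$.
   Context: For an integer $k\ge 2$ and integers $\beta, n\ge 0$, consider the integer lattice paths from $(0,0)$ to $(kn+\beta,\beta)$ using steps $U=(1,1)$ and $D=(1,1-k)$ that stay weakly above the line $y=0$ (such paths have exactly $n$ steps $D$; the empty path is included when $n=\beta=0$). A return to ground is a $D$ step whose right endpoint lies on $y=0$ (the initial point $(0,0)$ is not a return). $C^k_{n,(0,\beta),\rho}$ is the number of such paths with exactly $\rho$ returns to ground. Convention: $\binom{a}{b}=0$ if $a<0$ or $b<0$. -}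

module Defs where

open import Data.Nat using (ℕ; zero; suc; _+_; _*_; _∸_; _<ᵇ_)
open import Data.Nat.Combinatorics using (_C_)
open import Data.Integer as ℤ using (ℤ; +_; -[1+_])
open import Data.List using (List; []; _∷_; map; _++_; filterᵇ; length)
open import Data.Bool using (Bool; true; false; _∧_; if_then_else_)
open import Data.Maybe using (Maybe; just; nothing)
open import Data.Product using (_×_; _,_)
open import Data.Nat using (_≡ᵇ_)

-- Steps U = (1,1) and D = (1,1-k).
data Step : Set where
  U D : Step

words : ℕ → List (List Step)
words zero = [] ∷ []
words (suc L) = map (U ∷_) (words L) ++ map (D ∷_) (words L)

numD : List Step → ℕ
numD [] = 0
numD (U ∷ w) = numD w
numD (D ∷ w) = suc (numD w)

-- Returns nothing if the path ever goes strictly below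
-- y = 0; otherwise just (final height , number of returns), where a return
-- is a D step whose right endpoint lies on y = 0.
walk : ℕ → ℕ → ℕ → List Step → Maybe (ℕ × ℕ)
walk k h r [] = just (h , r)
walk k h r (U ∷ w) = walk k (suc h) r w
walk k h r (D ∷ w) =
  if h <ᵇ (k ∸ 1) then nothing
  else walk k (h ∸ (k ∸ 1)) (if (h ∸ (k ∸ 1)) ≡ᵇ 0 then suc r else r) w

-- Is w a path from (0,0) to (kn+β, β) with steps U, D, weakly above y=0,
-- with exactly n D steps and exactly ρ returns?  (Its length is kn+β
-- by construction of the enumeration below.)
good : ℕ → ℕ → ℕ → ℕ → List Step → Bool
good k n β ρ w with walk k 0 0 w
... | nothing = false
... | just (h , r) = (h ≡ᵇ β) ∧ (r ≡ᵇ ρ) ∧ (numD w ≡ᵇ n)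

-- C^k_{n,(0,β),ρ}: number of such paths (paths from (0,0) to (kn+β,β)
-- have exactly kn+β steps, since each step advances x by 1).
Ck : ℕ → ℕ → ℕ → ℕ → ℕ
Ck k n β ρ = length (filterᵇ (good k n β ρ) (words (k * n + β)))

binomℤ : ℤ → ℤ → ℤ
binomℤ (+ a) (+ b) = + (a C b)
binomℤ _ _ = + 0

-- Classify paths by their last step. The endpoint data (number of D steps, final height, returns)
-- before the last step is determined by the data after it, so the path counts satisfy a last-step
-- recurrence. The same recurrence holds for the numbers obtained by trading each return for one D step
-- fewer and c = k - 1 more units of final height, down to the number P(m, a) of paths with m steps D
-- to height a that never return to the ground. By Pascal's rule
-- P(m, a) = C(mk + a, m) - k C(mk + a - 1, m - 1), and absorption m C(N, m) = N C(N - 1, m - 1)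
-- turns this into the ballot formula (mk + a) P(m, a) = a C(mk + a, m).

module Submission where

open import Defs

module PathCounting where
  open import Data.Nat
    using (ℕ; zero; suc; _+_; _*_; _∸_; _≤_; _<_; _<ᵇ_; _≡ᵇ_; s≤s)
  open import Data.Nat.Properties
  open import Data.Nat.Combinatorics using (_C_; nCk+nC[k+1]≡[n+1]C[k+1]; nC1≡n)
  open import Data.Nat.Tactic.RingSolver using (solve-∀)
  open import Algebra.Properties.CommutativeSemigroup +-commutativeSemigroup using (interchange)
  open import Data.Integer as ℤ using (+_; -[1+_]; _⊖_)
  import Data.Integer.Properties as ℤ
  open import Data.Bool using (Bool; true; false; _∧_; if_then_else_; T?)
  open import Data.Bool.Properties using (∧-zeroʳ)
  open import Data.List using (List; []; _∷_; map; _++_; filterᵇ; length)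
  open import Data.List.Properties using (length-++; filter-++)
  open import Data.Maybe using (Maybe; just; nothing; _>>=_)
  open import Data.Maybe.Relation.Unary.All using (All; just; nothing)
  open import Data.Product using (Σ; _×_; _,_)
  open import Data.Sum using (_⊎_; inj₁; inj₂)
  open import Function using (_∘_)
  open import Relation.Binary.PropositionalEquality
  open ≡-Reasoning

  count : (List Step → Bool) → List (List Step) → ℕ
  count p ws = length (filterᵇ p ws)

  count-++ : ∀ p us vs → count p (us ++ vs) ≡ count p us + count p vs
  count-++ p us vs = trans (cong length (filter-++ (T? ∘ p) us vs)) (length-++ (filterᵇ p us))

  count-map : ∀ p (f : List Step → List Step) ws → count p (map f ws) ≡ count (p ∘ f) ws
  count-map p f [] = refl
  count-map p f (w ∷ ws) with p (f w)
  ... | true = cong suc (count-map p f ws)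
  ... | false = count-map p f ws

  count-cong : ∀ {p q} → (∀ w → p w ≡ q w) → ∀ ws → count p ws ≡ count q ws
  count-cong p≗q [] = refl
  count-cong {q = q} p≗q (w ∷ ws) rewrite p≗q w with q w
  ... | true = cong suc (count-cong p≗q ws)
  ... | false = count-cong p≗q ws

  count-none : ∀ ws → count (λ _ → false) ws ≡ 0
  count-none [] = refl
  count-none (w ∷ ws) = count-none ws

  count-words-suc : ∀ L p →
    count p (words (suc L)) ≡ count (p ∘ (U ∷_)) (words L) + count (p ∘ (D ∷_)) (words L)
  count-words-suc L p = begin
    count p (map (U ∷_) (words L) ++ map (D ∷_) (words L))
      ≡⟨ count-++ p (map (U ∷_) (words L)) (map (D ∷_) (words L)) ⟩
    count p (map (U ∷_) (words L)) + count p (map (D ∷_) (words L))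
      ≡⟨ cong₂ _+_ (count-map p (U ∷_) (words L)) (count-map p (D ∷_) (words L)) ⟩
    count (p ∘ (U ∷_)) (words L) + count (p ∘ (D ∷_)) (words L) ∎

  count-words-snoc : ∀ L p →
    count p (words (suc L)) ≡ count (p ∘ (_++ U ∷ [])) (words L) + count (p ∘ (_++ D ∷ [])) (words L)
  count-words-snoc zero p = begin
    count p (map (_++ U ∷ []) ([] ∷ []) ++ map (_++ D ∷ []) ([] ∷ []))
      ≡⟨ count-++ p (map (_++ U ∷ []) ([] ∷ [])) (map (_++ D ∷ []) ([] ∷ [])) ⟩
    count p (map (_++ U ∷ []) ([] ∷ [])) + count p (map (_++ D ∷ []) ([] ∷ []))
      ≡⟨ cong₂ _+_ (count-map p (_++ U ∷ []) ([] ∷ [])) (count-map p (_++ D ∷ []) ([] ∷ [])) ⟩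
    count (p ∘ (_++ U ∷ [])) (words zero) + count (p ∘ (_++ D ∷ [])) (words zero) ∎
  count-words-snoc (suc L) p = begin
    count p (words (suc (suc L)))
      ≡⟨ count-words-suc (suc L) p ⟩
    count (p ∘ (U ∷_)) (words (suc L)) + count (p ∘ (D ∷_)) (words (suc L))
      ≡⟨ cong₂ _+_ (count-words-snoc L (p ∘ (U ∷_))) (count-words-snoc L (p ∘ (D ∷_))) ⟩
    (count pUU (words L) + count pUD (words L)) + (count pDU (words L) + count pDD (words L))
      ≡⟨ interchange (count pUU (words L)) (count pUD (words L)) (count pDU (words L)) (count pDD (words L)) ⟩
    (count pUU (words L) + count pDU (words L)) + (count pUD (words L) + count pDD (words L))
      ≡⟨ cong₂ _+_ (count-words-suc L (p ∘ (_++ U ∷ []))) (count-words-suc L (p ∘ (_++ D ∷ []))) ⟨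
    count (p ∘ (_++ U ∷ [])) (words (suc L)) + count (p ∘ (_++ D ∷ [])) (words (suc L)) ∎
    where
    pUU pUD pDU pDD : List Step → Bool
    pUU w = p (U ∷ w ++ U ∷ [])
    pUD w = p (U ∷ w ++ D ∷ [])
    pDU w = p (D ∷ w ++ U ∷ [])
    pDD w = p (D ∷ w ++ D ∷ [])

  numD-++ : ∀ v w → numD (v ++ w) ≡ numD v + numD w
  numD-++ [] w = refl
  numD-++ (U ∷ v) w = numD-++ v w
  numD-++ (D ∷ v) w = cong suc (numD-++ v w)

  step : ℕ → Step → ℕ × ℕ → Maybe (ℕ × ℕ)
  step k U (h , r) = just (suc h , r)
  step k D (h , r) =
    if h <ᵇ (k ∸ 1) then nothing
    else just (h ∸ (k ∸ 1) , (if (h ∸ (k ∸ 1)) ≡ᵇ 0 then suc r else r))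

  walk-snoc : ∀ k h r w s → walk k h r (w ++ s ∷ []) ≡ (walk k h r w >>= step k s)
  walk-snoc k h r [] U = refl
  walk-snoc k h r [] D = refl
  walk-snoc k h r (U ∷ w) s = walk-snoc k (suc h) r w s
  walk-snoc k h r (D ∷ w) s with h <ᵇ (k ∸ 1)
  ... | true = refl
  ... | false = walk-snoc k _ _ w s

  below-or-above : ∀ a c → (a <ᵇ c) ≡ true ⊎ Σ ℕ (λ e → a ≡ c + e)
  below-or-above a zero = inj₂ (a , refl)
  below-or-above zero (suc c) = inj₁ refl
  below-or-above (suc a) (suc c) with below-or-above a c
  ... | inj₁ a<c = inj₁ a<c
  ... | inj₂ (e , refl) = inj₂ (e , refl)

  [m+n<ᵇm]≡false : ∀ m n → (m + n <ᵇ m) ≡ false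
  [m+n<ᵇm]≡false zero n = refl
  [m+n<ᵇm]≡false (suc m) n = [m+n<ᵇm]≡false m n

  m<ᵇn⇒[m≡ᵇo+n]≡false : ∀ m n o → (m <ᵇ n) ≡ true → (m ≡ᵇ o + n) ≡ false
  m<ᵇn⇒[m≡ᵇo+n]≡false zero (suc n) o _ rewrite +-suc o n = refl
  m<ᵇn⇒[m≡ᵇo+n]≡false (suc m) (suc n) o m<n rewrite +-suc o n = m<ᵇn⇒[m≡ᵇo+n]≡false m n o m<n

  [m+n≡ᵇo+m]≡[n≡ᵇo] : ∀ m n o → (m + n ≡ᵇ o + m) ≡ (n ≡ᵇ o)
  [m+n≡ᵇo+m]≡[n≡ᵇo] zero n o rewrite +-identityʳ o = refl
  [m+n≡ᵇo+m]≡[n≡ᵇo] (suc m) n o rewrite +-suc o m = [m+n≡ᵇo+m]≡[n≡ᵇo] m n o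

  [k+1]*[n+1]C[k+1]≡[n+1]*nCk : ∀ n k → suc k * (suc n C suc k) ≡ suc n * (n C k)
  [k+1]*[n+1]C[k+1]≡[n+1]*nCk zero zero = refl
  [k+1]*[n+1]C[k+1]≡[n+1]*nCk zero (suc k) = *-zeroʳ (suc (suc k))
  [k+1]*[n+1]C[k+1]≡[n+1]*nCk (suc n) zero = trans (+-identityʳ _) (trans (nC1≡n (suc (suc n))) (sym (*-identityʳ _)))
  [k+1]*[n+1]C[k+1]≡[n+1]*nCk (suc n) (suc k) = begin
    suc (suc k) * (suc (suc n) C suc (suc k))
      ≡⟨ cong (suc (suc k) *_) (nCk+nC[k+1]≡[n+1]C[k+1] (suc n) (suc k)) ⟨
    suc (suc k) * (suc n C suc k + suc n C suc (suc k))
      ≡⟨ expand k (suc n C suc k) (suc n C suc (suc k)) ⟩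
    suc k * (suc n C suc k) + suc (suc k) * (suc n C suc (suc k)) + suc n C suc k
      ≡⟨ cong₂ (λ x y → x + y + suc n C suc k) ([k+1]*[n+1]C[k+1]≡[n+1]*nCk n k) ([k+1]*[n+1]C[k+1]≡[n+1]*nCk n (suc k)) ⟩
    suc n * (n C k) + suc n * (n C suc k) + suc n C suc k
      ≡⟨ cong (_+ suc n C suc k) (*-distribˡ-+ (suc n) (n C k) (n C suc k)) ⟨
    suc n * (n C k + n C suc k) + suc n C suc k
      ≡⟨ cong (λ x → suc n * x + suc n C suc k) (nCk+nC[k+1]≡[n+1]C[k+1] n k) ⟩
    suc n * (suc n C suc k) + suc n C suc k
      ≡⟨ +-comm (suc n * (suc n C suc k)) _ ⟩
    suc (suc n) * (suc n C suc k) ∎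
    where
    expand : ∀ k x y → suc (suc k) * (x + y) ≡ suc k * x + suc (suc k) * y + x
    expand = solve-∀

  +[m+n]-+m≡+n : ∀ m n → + (m + n) ℤ.- + m ≡ + n
  +[m+n]-+m≡+n m n = begin
    + (m + n) ℤ.- + m     ≡⟨ ℤ.m-n≡m⊖n (m + n) m ⟩
    (m + n) ⊖ m           ≡⟨ cong ((m + n) ⊖_) (+-identityʳ m) ⟨
    (m + n) ⊖ (m + 0)     ≡⟨ ℤ.+-cancelˡ-⊖ m n 0 ⟩
    + n                   ∎

  +m-+[1+m+n]≡-[1+n] : ∀ m n → + m ℤ.- + suc (m + n) ≡ -[1+ n ]
  +m-+[1+m+n]≡-[1+n] m n = begin
    + m ℤ.- + suc (m + n)  ≡⟨ ℤ.m-n≡m⊖n m (suc (m + n)) ⟩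
    m ⊖ suc (m + n)        ≡⟨ cong₂ _⊖_ (+-identityʳ m) (+-suc m n) ⟨
    (m + 0) ⊖ (m + suc n)  ≡⟨ ℤ.+-cancelˡ-⊖ m 0 (suc n) ⟩
    -[1+ n ]               ∎

  +x*+y++z-+w≡+v : ∀ x y z w {v} → x * y + z ≡ w + v → + x ℤ.* + y ℤ.+ + z ℤ.- + w ≡ + v
  +x*+y++z-+w≡+v x y z w {v} eq = begin
    + x ℤ.* + y ℤ.+ + z ℤ.- + w  ≡⟨ cong (λ i → i ℤ.+ + z ℤ.- + w) (ℤ.pos-* x y) ⟨
    + (x * y) ℤ.+ + z ℤ.- + w    ≡⟨ cong (ℤ._- + w) (ℤ.pos-+ (x * y) z) ⟨
    + (x * y + z) ℤ.- + w        ≡⟨ cong (λ i → + i ℤ.- + w) eq ⟩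
    + (w + v) ℤ.- + w            ≡⟨ +[m+n]-+m≡+n w v ⟩
    + v                          ∎

  binomℤ-negative : ∀ x n → binomℤ x -[1+ n ] ≡ + 0
  binomℤ-negative (+ _) n = refl
  binomℤ-negative -[1+ _ ] n = refl

  module _ (c : ℕ) where

    private
      k : ℕ
      k = suc c

    -- (number of D steps, final height, number of returns)
    Target : Set
    Target = ℕ × ℕ × ℕ

    weight : Target → ℕ
    weight (d , h , r) = d * k + h

    hits : Target → Maybe (ℕ × ℕ) → ℕ → Bool
    hits _ nothing _ = false
    hits (d , h , r) (just (a , b)) n = (a ≡ᵇ h) ∧ (b ≡ᵇ r) ∧ (n ≡ᵇ d)

    hitsᴹ : Maybe Target → Maybe (ℕ × ℕ) → ℕ → Bool
    hitsᴹ nothing _ _ = false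
    hitsᴹ (just t) = hits t

    hitsᴹ-nothing : ∀ mt n → hitsᴹ mt nothing n ≡ false
    hitsᴹ-nothing nothing n = refl
    hitsᴹ-nothing (just t) n = refl

    reaches : Maybe Target → List Step → Bool
    reaches mt w = hitsᴹ mt (walk k 0 0 w) (numD w)

    good≡reaches : ∀ d h r w → good k d h r w ≡ reaches (just (d , h , r)) w
    good≡reaches d h r w with walk k 0 0 w
    ... | nothing = refl
    ... | just _ = refl

    -- The endpoint a path must have for the path extended by the given step to end at the target;
    -- a D step ending on the ground is a return.
    before : Step → Target → Maybe Target
    before U (d , zero , r) = nothing
    before U (d , suc h , r) = just (d , h , r)
    before D (zero , h , r) = nothing
    before D (suc d , zero , zero) = nothing
    before D (suc d , zero , suc r) = just (d , c , r)
    before D (suc d , suc h , r) = just (d , suc h + c , r)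

    weight-before-D : ∀ d h → suc (d * k + (h + c)) ≡ suc d * k + h
    weight-before-D d h = lemma c d h
      where
      lemma : ∀ c d h → suc (d * suc c + (h + c)) ≡ suc d * suc c + h
      lemma = solve-∀

    weight-before : ∀ s t → All (λ t′ → suc (weight t′) ≡ weight t) (before s t)
    weight-before U (d , zero , r) = nothing
    weight-before U (d , suc h , r) = just (sym (+-suc (d * k) h))
    weight-before D (zero , h , r) = nothing
    weight-before D (suc d , zero , zero) = nothing
    weight-before D (suc d , zero , suc r) = just (weight-before-D d 0)
    weight-before D (suc d , suc h , r) = just (weight-before-D d (suc h))

    hits-D-below : ∀ t {a} b n → (a <ᵇ c) ≡ true → hitsᴹ (before D t) (just (a , b)) n ≡ false
    hits-D-below (zero , h , r) b n a<c = refl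
    hits-D-below (suc d , zero , zero) b n a<c = refl
    hits-D-below (suc d , zero , suc r) {a} b n a<c rewrite m<ᵇn⇒[m≡ᵇo+n]≡false a c 0 a<c = refl
    hits-D-below (suc d , suc h , r) {a} b n a<c rewrite m<ᵇn⇒[m≡ᵇo+n]≡false a c (suc h) a<c = refl

    hits-D-above : ∀ t e b n →
      hits t (just (e , (if e ≡ᵇ 0 then suc b else b))) (suc n) ≡ hitsᴹ (before D t) (just (c + e , b)) n
    hits-D-above (zero , h , r) e b n = trans (cong ((e ≡ᵇ h) ∧_) (∧-zeroʳ _)) (∧-zeroʳ _)
    hits-D-above (suc d , zero , zero) zero b n = refl
    hits-D-above (suc d , zero , zero) (suc e) b n = refl
    hits-D-above (suc d , zero , suc r) e b n rewrite [m+n≡ᵇo+m]≡[n≡ᵇo] c e 0 with e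
    ... | zero = refl
    ... | suc _ = refl
    hits-D-above (suc d , suc h , r) e b n rewrite [m+n≡ᵇo+m]≡[n≡ᵇo] c e (suc h) with e
    ... | zero = refl
    ... | suc _ = refl

    hits-step : ∀ s t m n → hits t (m >>= step k s) (numD (s ∷ []) + n) ≡ hitsᴹ (before s t) m n
    hits-step s t nothing n = sym (hitsᴹ-nothing (before s t) n)
    hits-step U (d , zero , r) (just _) n = refl
    hits-step U (d , suc h , r) (just _) n = refl
    hits-step D t (just (a , b)) n with below-or-above a c
    ... | inj₁ a<c rewrite a<c = sym (hits-D-below t b n a<c)
    ... | inj₂ (e , refl) rewrite [m+n<ᵇm]≡false c e | m+n∸m≡n c e = hits-D-above t e b n

    reaches-snoc : ∀ s t w → reaches (just t) (w ++ s ∷ []) ≡ reaches (before s t) w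
    reaches-snoc s t w = begin
      hits t (walk k 0 0 (w ++ s ∷ [])) (numD (w ++ s ∷ []))
        ≡⟨ cong₂ (hits t) (walk-snoc k 0 0 w s) (trans (numD-++ w (s ∷ [])) (+-comm (numD w) _)) ⟩
      hits t (walk k 0 0 w >>= step k s) (numD (s ∷ []) + numD w)
        ≡⟨ hits-step s t (walk k 0 0 w) (numD w) ⟩
      hitsᴹ (before s t) (walk k 0 0 w) (numD w) ∎

    -- positive m a counts the paths with m steps D ending at height a that never return to the ground.
    positive : ℕ → ℕ → ℕ
    positive zero a = 1
    positive (suc m) zero = 0
    positive (suc m) (suc a) = positive (suc m) a + positive m (suc a + c)

    paths : ℕ → ℕ → ℕ → ℕ
    paths d h zero = positive d h
    paths zero h (suc r) = 0
    paths (suc d) h (suc r) = paths d (h + c) r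

    pathsᴹ : Maybe Target → ℕ
    pathsᴹ nothing = 0
    pathsᴹ (just (d , h , r)) = paths d h r

    paths-suc-height : ∀ d h r → paths (suc d) (suc h) r ≡ paths (suc d) h r + paths d (suc h + c) r
    paths-suc-height d h zero = refl
    paths-suc-height zero h (suc zero) = refl
    paths-suc-height zero h (suc (suc r)) = refl
    paths-suc-height (suc d) h (suc r) = paths-suc-height d (h + c) r

    paths-last-step : ∀ t {L} → weight t ≡ suc L → pathsᴹ (just t) ≡ pathsᴹ (before U t) + pathsᴹ (before D t)
    paths-last-step (zero , suc h , zero) _ = refl
    paths-last-step (zero , suc h , suc r) _ = refl
    paths-last-step (suc d , zero , zero) _ = refl
    paths-last-step (suc d , zero , suc r) _ = refl
    paths-last-step (suc d , suc h , r) _ = paths-suc-height d h r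

    count-reaches : ∀ L t → weight t ≡ L → count (reaches (just t)) (words L) ≡ pathsᴹ (just t)
    count-reaches zero (zero , zero , zero) _ = refl
    count-reaches zero (zero , zero , suc r) _ = refl
    count-reaches (suc L) t weight≡1+L = begin
      count (reaches (just t)) (words (suc L))
        ≡⟨ count-words-snoc L (reaches (just t)) ⟩
      count (reaches (just t) ∘ (_++ U ∷ [])) (words L) + count (reaches (just t) ∘ (_++ D ∷ [])) (words L)
        ≡⟨ cong₂ _+_ (count-before U) (count-before D) ⟩
      pathsᴹ (before U t) + pathsᴹ (before D t)
        ≡⟨ paths-last-step t weight≡1+L ⟨
      pathsᴹ (just t) ∎
      where
      count-shorter : ∀ mt → All (λ t′ → suc (weight t′) ≡ weight t) mt → count (reaches mt) (words L) ≡ pathsᴹ mt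
      count-shorter nothing nothing = count-none (words L)
      count-shorter (just t′) (just 1+weight≡weight) = count-reaches L t′ (suc-injective (trans 1+weight≡weight weight≡1+L))

      count-before : ∀ s → count (reaches (just t) ∘ (_++ s ∷ [])) (words L) ≡ pathsᴹ (before s t)
      count-before s = trans (count-cong (reaches-snoc s t) (words L)) (count-shorter (before s t) (weight-before s t))

    paths-closed : ∀ d h r → r ≤ d → paths d h r ≡ positive (d ∸ r) (r * c + h)
    paths-closed d h zero _ = refl
    paths-closed (suc d) h (suc r) (s≤s r≤d) =
      trans (paths-closed d (h + c) r r≤d) (cong (positive (d ∸ r)) (regroup c r h))
      where
      regroup : ∀ c r h → r * c + (h + c) ≡ suc r * c + h
      regroup = solve-∀

    paths-vanishes : ∀ d h r → d < r → paths d h r ≡ 0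
    paths-vanishes zero h (suc r) _ = refl
    paths-vanishes (suc d) h (suc r) (s≤s d<r) = paths-vanishes d (h + c) r d<r

    Ck≡paths : ∀ n β ρ → Ck k n β ρ ≡ paths n β ρ
    Ck≡paths n β ρ =
      trans (count-cong (good≡reaches n β ρ) (words (k * n + β)))
            (count-reaches (k * n + β) (n , β , ρ) (cong (_+ β) (*-comm n k)))

    lowerBinomial : ℕ → ℕ → ℕ
    lowerBinomial zero a = 0
    lowerBinomial (suc m) a = (c + m * k + a) C m

    lowerBinomial-split : ∀ m a → (c + m * k + suc a) C m ≡ lowerBinomial m (suc a + c) + lowerBinomial (suc m) a
    lowerBinomial-split zero a = refl
    lowerBinomial-split (suc m) a = begin
      (c + suc m * k + suc a) C suc m         ≡⟨ cong (_C suc m) (+-suc (c + suc m * k) a) ⟩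
      suc Z C suc m                           ≡⟨ nCk+nC[k+1]≡[n+1]C[k+1] Z m ⟨
      Z C m + Z C suc m                       ≡⟨ cong (λ x → x C m + Z C suc m) (regroup c m a) ⟩
      (c + m * k + (suc a + c)) C m + Z C suc m ∎
      where
      Z = c + suc m * k + a
      regroup : ∀ c m a → c + suc m * suc c + a ≡ c + m * suc c + (suc a + c)
      regroup = solve-∀

    positive+lowerBinomial*k : ∀ m a → positive m a + lowerBinomial m a * k ≡ (m * k + a) C m
    positive+lowerBinomial*k zero a = refl
    positive+lowerBinomial*k (suc m) zero = *-cancelˡ-≡ _ _ (suc m) (begin
      suc m * ((X C m) * k)       ≡⟨ regroup m c (X C m) ⟩
      suc X * (X C m)             ≡⟨ [k+1]*[n+1]C[k+1]≡[n+1]*nCk X m ⟨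
      suc m * (suc X C suc m)     ∎)
      where
      X = c + m * k + 0
      regroup : ∀ m c y → suc m * (y * suc c) ≡ (suc m * suc c + 0) * y
      regroup = solve-∀
    positive+lowerBinomial*k (suc m) (suc a) = begin
      (p₁ + p₂) + lowerBinomial (suc m) (suc a) * k
        ≡⟨ cong (λ x → (p₁ + p₂) + x * k) (lowerBinomial-split m a) ⟩
      (p₁ + p₂) + (b₂ + b₁) * k
        ≡⟨ regroup p₁ p₂ b₁ b₂ k ⟩
      (p₁ + b₁ * k) + (p₂ + b₂ * k)
        ≡⟨ cong₂ _+_ (positive+lowerBinomial*k (suc m) a) (positive+lowerBinomial*k m (suc a + c)) ⟩
      X C suc m + (m * k + (suc a + c)) C m
        ≡⟨ cong (λ x → X C suc m + x C m) (shift c m a) ⟩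
      X C suc m + X C m
        ≡⟨ +-comm (X C suc m) (X C m) ⟩
      X C m + X C suc m
        ≡⟨ nCk+nC[k+1]≡[n+1]C[k+1] X m ⟩
      suc X C suc m
        ≡⟨ cong (_C suc m) (+-suc (suc m * k) a) ⟨
      (suc m * k + suc a) C suc m ∎
      where
      p₁ = positive (suc m) a
      p₂ = positive m (suc a + c)
      b₁ = lowerBinomial (suc m) a
      b₂ = lowerBinomial m (suc a + c)
      X = suc m * k + a
      regroup : ∀ p₁ p₂ b₁ b₂ k → (p₁ + p₂) + (b₂ + b₁) * k ≡ (p₁ + b₁ * k) + (p₂ + b₂ * k)
      regroup = solve-∀
      shift : ∀ c m a → m * suc c + (suc a + c) ≡ suc m * suc c + a
      shift = solve-∀

    lowerBinomial-absorption : ∀ m a → (m * k + a) * lowerBinomial m a ≡ m * ((m * k + a) C m)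
    lowerBinomial-absorption zero a = *-zeroʳ a
    lowerBinomial-absorption (suc m) a = sym ([k+1]*[n+1]C[k+1]≡[n+1]*nCk (c + m * k + a) m)

    ballot : ∀ m a → (m * k + a) * positive m a ≡ a * ((m * k + a) C m)
    ballot m a = +-cancelʳ-≡ (m * B * k) _ _ (begin
      N * positive m a + m * B * k            ≡⟨ cong (λ x → N * positive m a + x * k) (lowerBinomial-absorption m a) ⟨
      N * positive m a + N * lowerBinomial m a * k ≡⟨ factor N (positive m a) (lowerBinomial m a) k ⟩
      N * (positive m a + lowerBinomial m a * k) ≡⟨ cong (N *_) (positive+lowerBinomial*k m a) ⟩
      N * B                                   ≡⟨ expand m k a B ⟩
      a * B + m * B * k                       ∎)
      where
      N = m * k + a
      B = N C m
      factor : ∀ n p b k → n * p + n * b * k ≡ n * (p + b * k)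
      factor = solve-∀
      expand : ∀ m k a b → (m * k + a) * b ≡ a * b + m * b * k
      expand = solve-∀

    CrossMultiplied : ℕ → ℕ → ℕ → Set
    CrossMultiplied n β ρ =
      (+ k ℤ.* + n ℤ.+ + β ℤ.- + ρ) ℤ.* + Ck k n β ρ
        ≡ (+ k ℤ.* + ρ ℤ.+ + β ℤ.- + ρ) ℤ.* binomℤ (+ k ℤ.* + n ℤ.+ + β ℤ.- + ρ) (+ n ℤ.- + ρ)

    cross-multiplied-≤ : ∀ {n} β {ρ} → ρ ≤ n → CrossMultiplied n β ρ
    cross-multiplied-≤ β {ρ} ρ≤n with m≤n⇒∃[o]m+o≡n ρ≤n
    ... | m , refl = begin
      (+ k ℤ.* + (ρ + m) ℤ.+ + β ℤ.- + ρ) ℤ.* + Ck k (ρ + m) β ρ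
        ≡⟨ cong₂ ℤ._*_ (+x*+y++z-+w≡+v k (ρ + m) β ρ length≡) (cong +_ Ck≡positive) ⟩
      + N ℤ.* + positive m a
        ≡⟨ ℤ.pos-* N (positive m a) ⟨
      + (N * positive m a)
        ≡⟨ cong +_ (ballot m a) ⟩
      + (a * (N C m))
        ≡⟨ ℤ.pos-* a (N C m) ⟩
      + a ℤ.* + (N C m)
        ≡⟨ cong₂ ℤ._*_ (+x*+y++z-+w≡+v k ρ β ρ height≡) (cong₂ binomℤ (+x*+y++z-+w≡+v k (ρ + m) β ρ length≡) (+[m+n]-+m≡+n ρ m)) ⟨
      (+ k ℤ.* + ρ ℤ.+ + β ℤ.- + ρ) ℤ.* binomℤ (+ k ℤ.* + (ρ + m) ℤ.+ + β ℤ.- + ρ) (+ (ρ + m) ℤ.- + ρ) ∎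
      where
      a = ρ * c + β
      N = m * k + a
      length≡ : k * (ρ + m) + β ≡ ρ + N
      length≡ = lemma c ρ m β
        where
        lemma : ∀ c ρ m β → suc c * (ρ + m) + β ≡ ρ + (m * suc c + (ρ * c + β))
        lemma = solve-∀
      height≡ : k * ρ + β ≡ ρ + a
      height≡ = lemma c ρ β
        where
        lemma : ∀ c ρ β → suc c * ρ + β ≡ ρ + (ρ * c + β)
        lemma = solve-∀
      Ck≡positive : Ck k (ρ + m) β ρ ≡ positive m a
      Ck≡positive = begin
        Ck k (ρ + m) β ρ                 ≡⟨ Ck≡paths (ρ + m) β ρ ⟩
        paths (ρ + m) β ρ                ≡⟨ paths-closed (ρ + m) β ρ (m≤m+n ρ m) ⟩
        positive (ρ + m ∸ ρ) a           ≡⟨ cong (λ d → positive d a) (m+n∸m≡n ρ m) ⟩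
        positive m a                     ∎

    cross-multiplied-> : ∀ {n} β {ρ} → n < ρ → CrossMultiplied n β ρ
    cross-multiplied-> {n} β n<ρ with m≤n⇒∃[o]m+o≡n n<ρ
    ... | t , refl = begin
      L ℤ.* + Ck k n β ρ     ≡⟨ cong (λ x → L ℤ.* + x) (trans (Ck≡paths n β ρ) (paths-vanishes n β ρ n<ρ)) ⟩
      L ℤ.* + 0              ≡⟨ ℤ.*-zeroʳ L ⟩
      + 0                    ≡⟨ ℤ.*-zeroʳ A ⟨
      A ℤ.* + 0              ≡⟨ cong (A ℤ.*_) (trans (cong (binomℤ L) (+m-+[1+m+n]≡-[1+n] n t)) (binomℤ-negative L t)) ⟨
      A ℤ.* binomℤ L (+ n ℤ.- + suc (n + t)) ∎
      where
      ρ = suc (n + t)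
      L = + k ℤ.* + n ℤ.+ + β ℤ.- + ρ
      A = + k ℤ.* + ρ ℤ.+ + β ℤ.- + ρ

    cross-multiplied : ∀ n β ρ → CrossMultiplied n β ρ
    cross-multiplied n β ρ with ≤-<-connex ρ n
    ... | inj₁ ρ≤n = cross-multiplied-≤ β ρ≤n
    ... | inj₂ n<ρ = cross-multiplied-> β n<ρ

open PathCounting using (Ck≡paths; cross-multiplied)
open import Data.Nat using (ℕ; _≤_; zero; suc)
open import Data.Integer using (+_; _+_; _-_; _*_)
open import Relation.Binary.PropositionalEquality using (_≡_; _≢_; refl)
open import Data.Product using (_×_; _,_)
open import Relation.Nullary using (¬_)

theorem3p8 : (k n β ρ : ℕ) → 2 ≤ k →
    ((n ≡ 0 × ρ ≡ 0 × β ≡ 0) → Ck k n β ρ ≡ 1) ×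
    (¬ (n ≡ 0 × ρ ≡ 0 × β ≡ 0) →
      (+ k * + n + + β - + ρ) ≢ + 0 →
      (+ k * + n + + β - + ρ) * + (Ck k n β ρ)
        ≡ (+ k * + ρ + + β - + ρ) * binomℤ (+ k * + n + + β - + ρ) (+ n - + ρ))
theorem3p8 zero n β ρ ()
theorem3p8 (suc c) n β ρ _ = empty-path , λ _ _ → cross-multiplied c n β ρ
  where
  empty-path : (n ≡ 0 × ρ ≡ 0 × β ≡ 0) → Ck (suc c) n β ρ ≡ 1
  empty-path (refl , refl , refl) = Ck≡paths c 0 0 0
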